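{- Let $\Gamma\Rightarrow\Delta$ and $S$ be set-based bi-nested sequents with $\Gamma\Rightarrow\Delta \in^{+} S$, and suppose $\Gamma\Rightarrow\Delta$ satisfies the saturation conditions of (trans) and $(\mathrm{inter}_{fc})$. If $\Delta$ is of the form $\Delta',\langle\Sigma\Rightarrow\Pi\rangle$, then $\Gamma\Rightarrow\Delta \subseteq^{S} \Sigma\Rightarrow\Pi$.
   Context: Set-based bi-nested sequents: $\Rightarrow$ is one; if $\Gamma,\Delta'$ are finite sets of formulas (of intuitionistic modal logic with $\wedge,\vee,\supset,\bot,\top,\Box,\Diamond$) and $S_i,T_j$ set-based bi-nested sequents, then $\Gamma\Rightarrow\Delta',\langle S_1\rangle,\dots,\langle S_m\rangle,[T_1],\dots,[T_n]$ is one, with antecedent $\Gamma$ and consequent the set $\Delta',\langle S_1\rangle,\dots,[T_n]$; $\langle\cdot\rangle$ are implication blocks and $[\cdot]$ modal blocks. Relations: $S_1\in^{\langle\cdot\rangle}_0 S_2$ iff $\langle S_1\rangle$ belongs to the consequent of $S_2$; $S_1\in^{[\cdot]}_0 S_2$ iff $[S_1]$ belongs to the consequent of $S_2$; $\in^{+}$ is the reflexive–transitive closure of $\in^{\langle\cdot\rangle}_0\cup\in^{[\cdot]}_0$. Structural inclusion: for $S_1=\Gamma_1\Rightarrow\Delta_1$ and $S_2=\Gamma_2\Rightarrow\Delta_2$ with $S_1,S_2\in^{+}S$, $S_1\subseteq^{S}S_2$ holds iff $\Gamma_1\subseteq\Gamma_2$ and for each $T_1\in^{[\cdot]}_0S_1$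 there exists $T_2\in^{[\cdot]}_0S_2$ with $T_1\subseteq^{S}T_2$ (defined recursively). Saturation conditions for a sequent $\Gamma\Rightarrow\Delta\in^{+}S$: (trans): if $\langle\Sigma\Rightarrow\Pi\rangle\in\Delta$ then $\Gamma\subseteq\Sigma$; $(\mathrm{inter}_{fc})$: if $\langle\Sigma\Rightarrow\Pi\rangle\in\Delta$ and $[\Lambda\Rightarrow\Theta]\in\Delta$, then there is $[\Phi\Rightarrow\Psi]\in\Pi$ with $\Lambda\Rightarrow\Theta\subseteq^{S}\Phi\Rightarrow\Psi$. -}

module Defs where

open import Data.Nat using (ℕ)
open import Data.List using (List)
open import Data.List.Membership.Propositional using (_∈_)
open import Data.List.Relation.Binary.Subset.Propositional using (_⊆_)
open import Data.Product using (Σ; _×_; ∃)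
open import Data.Sum using (_⊎_)
open import Relation.Binary.Construct.Closure.ReflexiveTransitive using (Star)

data Fm : Set where
  var  : ℕ → Fm
  ⊥′ ⊤′ : Fm
  _∧′_ _∨′_ _⊃′_ : Fm → Fm → Fm
  □′ ◇′ : Fm → Fm

-- Set-based bi-nested sequent  Γ ⇒ Δ', ⟨S₁⟩,…,⟨Sₘ⟩, [T₁],…,[Tₙ].
-- Finite sets are represented by lists; every notion below only uses
-- membership, so order and multiplicity are irrelevant.
data Seq : Set where
  seq : (ant : List Fm)
        (cons : List Fm)
        (imps : List Seq)
        (boxes : List Seq)
        → Seq

antecedent : Seq → List Fm
antecedent (seq Γ _ _ _) = Γ

formulas : Seq → List Fm
formulas (seq _ Δ _ _) = Δ

impBlocks : Seq → List Seq
impBlocks (seq _ _ I _) = I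

boxBlocks : Seq → List Seq
boxBlocks (seq _ _ _ B) = B

_∈⟨⟩₀_ : Seq → Seq → Set
S₁ ∈⟨⟩₀ S₂ = S₁ ∈ impBlocks S₂

_∈[]₀_ : Seq → Seq → Set
S₁ ∈[]₀ S₂ = S₁ ∈ boxBlocks S₂

_∈₀_ : Seq → Seq → Set
S₁ ∈₀ S₂ = (S₁ ∈⟨⟩₀ S₂) ⊎ (S₁ ∈[]₀ S₂)

_∈⁺_ : Seq → Seq → Set
_∈⁺_ = Star _∈₀_

-- Recursive structural inclusion (inductive, i.e. the least relation
-- satisfying the recursive clause; sequents are well-founded trees).
data _⊑_ : Seq → Seq → Set where
  incl : ∀ {S₁ S₂} →
         antecedent S₁ ⊆ antecedent S₂ →
         (∀ {T₁} → T₁ ∈[]₀ S₁ → ∃ λ T₂ → (T₂ ∈[]₀ S₂) × (T₁ ⊑ T₂)) →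
         S₁ ⊑ S₂

⊆[_] : Seq → Seq → Seq → Set
⊆[ S ] S₁ S₂ = (S₁ ∈⁺ S) × (S₂ ∈⁺ S) × (S₁ ⊑ S₂)

SatTrans : Seq → Set
SatTrans X = ∀ {Y} → Y ∈⟨⟩₀ X → antecedent X ⊆ antecedent Y

SatInterFc : Seq → Seq → Set
SatInterFc S X = ∀ {Y L} → Y ∈⟨⟩₀ X → L ∈[]₀ X →
                 ∃ λ P → (P ∈[]₀ Y) × ⊆[ S ] L P

module Submission where

open import Defs
open import Data.Sum using (inj₁)
open import Data.Product using (∃; _×_; _,_)
open import Relation.Binary.Construct.Closure.ReflexiveTransitive using (_◅_)

-- (trans) supplies the antecedent inclusion, and (inter_fc) supplies, for every
-- modal block of X, a modal block of the implication block Y that includes it;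
-- together these are exactly the clauses of structural inclusion X ⊑ Y.

implicationBlock-∈⁺ : ∀ {S X Y} → X ∈⁺ S → Y ∈⟨⟩₀ X → Y ∈⁺ S
implicationBlock-∈⁺ X∈⁺S Y∈X = inj₁ Y∈X ◅ X∈⁺S

interFc⇒boxBlocks-⊑ : ∀ {S} X Y → SatInterFc S X → Y ∈⟨⟩₀ X →
                      ∀ {L} → L ∈[]₀ X → ∃ λ P → (P ∈[]₀ Y) × (L ⊑ P)
interFc⇒boxBlocks-⊑ X Y inter Y∈X L∈X with inter Y∈X L∈X
... | P , P∈Y , _ , _ , L⊑P = P , P∈Y , L⊑P

saturated⇒⊑-implicationBlock : ∀ {S} X Y → SatTrans X → SatInterFc S X →
                               Y ∈⟨⟩₀ X → X ⊑ Y
saturated⇒⊑-implicationBlock X Y trans inter Y∈X =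
  incl (trans Y∈X) (interFc⇒boxBlocks-⊑ X Y inter Y∈X)

proposition3 : (S X Y : Seq) → X ∈⁺ S → SatTrans X → SatInterFc S X →
    Y ∈⟨⟩₀ X → ⊆[ S ] X Y
proposition3 S X Y X∈⁺S trans inter Y∈X =
  X∈⁺S , implicationBlock-∈⁺ X∈⁺S Y∈X , saturated⇒⊑-implicationBlock X Y trans inter Y∈X
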